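{- Let $G$ be a finite group and let $R$ be a complete noetherian local commutative ring with finite residue field $k$ and maximal ideal $\mathfrak m_R$, such that $|G|$ is not a zero-divisor in $R$. Let $J:=|G|\cdot\mathfrak m_R$. Then two representations $\rho_1,\rho_2:G\to\mathrm{GL}_n(R)$ are strictly equivalent if and only if their reductions $\pi_J\rho_1$ and $\pi_J\rho_2$ to $R/J$ are strictly equivalent.
   Context: $\pi_J$ denotes reduction modulo $J$. Representations $\rho_1,\rho_2:G\to\mathrm{GL}_n(R)$ are strictly equivalent if $\rho_1(g)=A\rho_2(g)A^{ -1}$ for all $g\in G$ for some $A\in I_n+M_n(\mathfrak m_R)$; similarly over $R/J$ with matrices in $I_n+M_n(\mathfrak m_R/J)$. -}

module Defs where

open import Level using (0ℓ)
open import Algebra.Bundles using (Group; CommutativeRing)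
open import Data.Nat using (ℕ; zero; suc)
open import Data.Fin using (Fin; zero; suc)
open import Data.Product using (Σ; ∃; _×_; _,_)
open import Data.Unit using (⊤)
open import Relation.Nullary using (¬_)
open import Relation.Binary.PropositionalEquality using (_≡_)
open import Function using (_∘_)

IsFiniteOfOrder : Group 0ℓ 0ℓ → ℕ → Set
IsFiniteOfOrder G N =
  Σ (Fin N → Carrier) λ e →
    (∀ g → ∃ λ i → e i ≈ g) × (∀ i j → e i ≈ e j → i ≡ j)
  where open Group G

module RingDefs (R : CommutativeRing 0ℓ 0ℓ) where
  open CommutativeRing R hiding (zero)

  sumF : ∀ {N} → (Fin N → Carrier) → Carrier
  sumF {zero} f = 0#
  sumF {suc N} f = f zero + sumF (f ∘ suc)

  natR : ℕ → Carrier
  natR zero = 0#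
  natR (suc k) = 1# + natR k

  IsUnit : Carrier → Set
  IsUnit x = ∃ λ y → x * y ≈ 1#

  -- the maximal ideal m_R of a local ring = the non-units
  InM : Carrier → Set
  InM x = ¬ IsUnit x

  -- local ring: 1 ≠ 0 and the non-units are closed under addition
  -- (hence form the unique maximal ideal)
  IsLocal : Set
  IsLocal = (¬ (1# ≈ 0#)) × (∀ x y → InM x → InM y → InM (x + y))

  record Ideal : Set₁ where
    field
      mem     : Carrier → Set
      mem-≈   : ∀ {x y} → x ≈ y → mem x → mem y
      mem-0   : mem 0#
      mem-+   : ∀ {x y} → mem x → mem y → mem (x + y)
      mem-*   : ∀ r {x} → mem x → mem (r * x)

  IsNoetherian : Set₁
  IsNoetherian = (I : Ideal) → let open Ideal I in
    ∃ λ N → Σ (Fin N → Carrier) λ gen →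
      (∀ i → mem (gen i)) ×
      (∀ x → mem x → Σ (Fin N → Carrier) λ c → x ≈ sumF (λ i → c i * gen i))

  InMPow : ℕ → Carrier → Set
  InMPow zero x = ⊤
  InMPow (suc k) x =
    ∃ λ N → Σ (Fin N → Carrier) λ a → Σ (Fin N → Carrier) λ b →
      (∀ i → InM (a i)) × (∀ i → InMPow k (b i)) × (x ≈ sumF (λ i → a i * b i))

  IsCauchy : (ℕ → Carrier) → Set
  IsCauchy s = ∀ k → ∃ λ N → ∀ i j → N Data.Nat.≤ i → N Data.Nat.≤ j → InMPow k (s i - s j)

  ConvergesTo : (ℕ → Carrier) → Carrier → Set
  ConvergesTo s L = ∀ k → ∃ λ N → ∀ i → N Data.Nat.≤ i → InMPow k (s i - L)

  -- complete (and separated) with respect to the m_R-adic topology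
  IsComplete : Set
  IsComplete =
    (∀ s → IsCauchy s → ∃ λ L → ConvergesTo s L) ×
    (∀ x → (∀ k → InMPow k x) → x ≈ 0#)

  -- residue field k = R / m_R is finite: finitely many residue classes
  FiniteResidueField : Set
  FiniteResidueField =
    ∃ λ N → Σ (Fin N → Carrier) λ f → ∀ x → ∃ λ i → InM (x - f i)

  NonZeroDivisor : Carrier → Set
  NonZeroDivisor a = ∀ x → a * x ≈ 0# → x ≈ 0#

  Mat : ℕ → Set
  Mat n = Fin n → Fin n → Carrier

  _·_ : ∀ {n} → Mat n → Mat n → Mat n
  (A · B) i j = sumF (λ l → A i l * B l j)

  δ : ∀ {n} → Mat n
  δ zero zero = 1#
  δ zero (suc j) = 0#
  δ (suc i) zero = 0#
  δ (suc i) (suc j) = δ i j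

  MatEq : (Carrier → Carrier → Set) → ∀ {n} → Mat n → Mat n → Set
  MatEq _∼_ A B = ∀ i j → A i j ∼ B i j

  -- the ideal J = |G| · m_R (for a given a = |G|), and congruence mod J
  InJ : Carrier → Carrier → Set
  InJ a x = ∃ λ y → InM y × (x ≈ a * y)

  _≡[mod_]_ : Carrier → Carrier → Carrier → Set
  x ≡[mod a ] y = InJ a (x - y)

  module _ (G : Group 0ℓ 0ℓ) where
    private module G = Group G

    record Rep (n : ℕ) : Set where
      field
        ρ     : G.Carrier → Mat n
        ρ-≈   : ∀ {g h} → g G.≈ h → MatEq _≈_ (ρ g) (ρ h)
        ρ-hom : ∀ g h → MatEq _≈_ (ρ (g G.∙ h)) (ρ g · ρ h)
        ρ-inv : ∀ g → ∃ λ B → MatEq _≈_ (ρ g · B) δ × MatEq _≈_ (B · ρ g) δ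

    -- strict equivalence with respect to an equality relation ∼ on entries
    -- (∼ = ≈ : over R;  ∼ = congruence mod J : over R/J).
    StrictEquivBy : (Carrier → Carrier → Set) → ∀ {n} → Rep n → Rep n → Set
    StrictEquivBy _∼_ {n} ρ₁ ρ₂ =
      Σ (Mat n) λ A → Σ (Mat n) λ B →
        (∀ i j → InM (A i j - δ i j)) ×
        MatEq _∼_ (A · B) δ × MatEq _∼_ (B · A) δ ×
        (∀ g → MatEq _∼_ (Rep.ρ ρ₁ g) ((A · Rep.ρ ρ₂ g) · B))

    StrictEquiv : ∀ {n} → Rep n → Rep n → Set
    StrictEquiv = StrictEquivBy _≈_

    StrictEquivModJ : Carrier → ∀ {n} → Rep n → Rep n → Set
    StrictEquivModJ a = StrictEquivBy (λ x y → x ≡[mod a ] y)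

module Submission where

-- One direction is immediate.  For the other, let A ∈ I + M_n(m) satisfy
-- ρ₁(g) ≡ A ρ₂(g) A⁻¹ (mod J) for all g.  Averaging over the group,
--   T = Σ_g ρ₁(g) A ρ₂(g⁻¹)
-- intertwines ρ₁ and ρ₂ exactly (translation invariance of sums over G), and
-- since every summand is ≡ A (mod |G|·m) we get T = |G|·A' with A' ∈ I + M_n(m).
-- Cancelling the non-zero-divisor |G| shows that A' itself intertwines, and A'
-- is invertible because I − A' has entries in m and R is m-adically complete
-- (Neumann series Σ (I − A')^i, whose limit is an inverse since R is separated).

open import Defs
open import Level using (0ℓ)
open import Algebra.Bundles using (Group; CommutativeRing)
open import Algebra.Bundles.Raw using (RawRing)
open import Function.Bundles using (_⇔_; mk⇔)
open import Function using (_∘_)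
open import Data.Nat as ℕ using (ℕ; zero; suc; z≤n; s≤s)
import Data.Nat.Properties as ℕₚ
open import Data.Fin using (Fin; zero; suc; splitAt)
open import Data.Vec.Functional using (_++_)
open import Data.Product using (Σ; ∃; _×_; _,_; proj₁; proj₂)
open import Data.Sum using (inj₁; inj₂)
open import Data.Unit using (tt)
open import Data.Maybe using (Maybe; just; nothing)
open import Relation.Nullary using (yes; no)
import Relation.Binary.PropositionalEquality as ≡
import Data.Fin.Permutation as Permutation
open Permutation using (_⟨$⟩ʳ_)
open import Relation.Binary.Bundles using (Setoid)
import Relation.Binary.Reasoning.Setoid
import Algebra.Properties.CommutativeMonoid.Sum

-- A ring solver for a commutative ring R that can cancel terms: its
-- coefficients are formal differences (p , q) of natural numbers, read as
-- p·1 − q·1 in R, whose equality is decidable.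
module IntegerCoefficientSolver (R : CommutativeRing 0ℓ 0ℓ) where
  open CommutativeRing R
  open import Algebra.Properties.Semiring.Mult semiring
    using (×-homo-+; ×1-homo-*) renaming (_×_ to _times_)
  open import Algebra.Properties.Ring ring using (x[y-z]≈xy-xz; [y-z]x≈yx-zx; -0#≈0#)
  open import Algebra.Properties.AbelianGroup +-abelianGroup using (⁻¹-anti-homo‿-; ⁻¹-∙-comm)
  open import Algebra.Solver.Ring.AlmostCommutativeRing
    using (fromCommutativeRing; _-Raw-AlmostCommutative⟶_; Induced-equivalence)
  import Tactic.RingSolver.Core.AlmostCommutativeRing as Tactic
  import Tactic.RingSolver.NonReflective as NonReflective
  open import Relation.Binary.Reasoning.Setoid setoid

  -- With R itself as coefficients the normaliser cannot cancel terms, but it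
  -- still proves rearrangements; these are all the interpretation needs.
  private module Rearrange = NonReflective (Tactic.fromCommutativeRing R (λ _ → nothing))
  open Rearrange using (_⊕_; ⊝_; _⊜_)

  ℤ-as-pairs : RawRing 0ℓ 0ℓ
  ℤ-as-pairs = record
    { Carrier = ℕ × ℕ ; _≈_ = ≡._≡_
    ; _+_ = λ { (a , b) (c , d) → (a ℕ.+ c , b ℕ.+ d) }
    ; _*_ = λ { (a , b) (c , d) → (a ℕ.* c ℕ.+ b ℕ.* d , a ℕ.* d ℕ.+ b ℕ.* c) }
    ; -_ = λ { (a , b) → (b , a) } ; 0# = (0 , 0) ; 1# = (1 , 0) }

  ⟦_⟧ℤ : ℕ × ℕ → Carrier
  ⟦ (p , q) ⟧ℤ = p times 1# - q times 1#

  expand-product : ∀ a b c d → (a * c + b * d) - (a * d + b * c) ≈ (a - b) * (c - d)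
  expand-product a b c d = sym (begin
    (a - b) * (c - d)                     ≈⟨ x[y-z]≈xy-xz (a - b) c d ⟩
    (a - b) * c - (a - b) * d             ≈⟨ +-cong ([y-z]x≈yx-zx c a b) (-‿cong ([y-z]x≈yx-zx d a b)) ⟩
    (a * c - b * c) - (a * d - b * d)     ≈⟨ +-congˡ (⁻¹-anti-homo‿- (a * d) (b * d)) ⟩
    (a * c - b * c) + (b * d - a * d)     ≈⟨ Rearrange.solve 4 (λ p q s nq → ((p ⊕ ⊝ q) ⊕ (s ⊕ nq)) ⊜ ((p ⊕ s) ⊕ (nq ⊕ ⊝ q))) refl (a * c) (b * c) (b * d) (- (a * d)) ⟩
    (a * c + b * d) + (- (a * d) - b * c) ≈⟨ +-congˡ (⁻¹-∙-comm (a * d) (b * c)) ⟩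
    (a * c + b * d) - (a * d + b * c)     ∎)

  interpretation : ℤ-as-pairs -Raw-AlmostCommutative⟶ fromCommutativeRing R
  interpretation = record
    { ⟦_⟧ = ⟦_⟧ℤ
    ; +-homo = λ { (a , b) (c , d) →
        trans (+-cong (×-homo-+ 1# a c) (-‿cong (×-homo-+ 1# b d)))
              (Rearrange.solve 4 (λ a b c d → ((a ⊕ c) ⊕ ⊝ (b ⊕ d)) ⊜ ((a ⊕ ⊝ b) ⊕ (c ⊕ ⊝ d))) refl
                 (a times 1#) (b times 1#) (c times 1#) (d times 1#)) }
    ; *-homo = λ { (a , b) (c , d) →
        trans (+-cong (trans (×-homo-+ 1# (a ℕ.* c) (b ℕ.* d)) (+-cong (×1-homo-* a c) (×1-homo-* b d)))
                      (-‿cong (trans (×-homo-+ 1# (a ℕ.* d) (b ℕ.* c)) (+-cong (×1-homo-* a d) (×1-homo-* b c)))))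
              (expand-product (a times 1#) (b times 1#) (c times 1#) (d times 1#)) }
    ; -‿homo = λ { (a , b) → sym (⁻¹-anti-homo‿- (a times 1#) (b times 1#)) }
    ; 0-homo = -‿inverseʳ 0#
    ; 1-homo = trans (+-congʳ (+-identityʳ 1#)) (trans (+-congˡ -0#≈0#) (+-identityʳ 1#))
    }

  difference-cong : ∀ a b c d → a + d ≈ c + b → a - b ≈ c - d
  difference-cong a b c d a+d≈c+b = begin
    a - b                 ≈⟨ sym (+-identityʳ _) ⟩
    (a - b) + 0#          ≈⟨ +-congˡ (sym (-‿inverseʳ d)) ⟩
    (a - b) + (d - d)     ≈⟨ Rearrange.solve 4 (λ a nb d nd → ((a ⊕ nb) ⊕ (d ⊕ nd)) ⊜ ((a ⊕ d) ⊕ (nd ⊕ nb))) refl a (- b) d (- d) ⟩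
    (a + d) + (- d - b)   ≈⟨ +-congʳ a+d≈c+b ⟩
    (c + b) + (- d - b)   ≈⟨ Rearrange.solve 4 (λ c b nd nb → ((c ⊕ b) ⊕ (nd ⊕ nb)) ⊜ ((c ⊕ nd) ⊕ (b ⊕ nb))) refl c b (- d) (- b) ⟩
    (c - d) + (b - b)     ≈⟨ +-congˡ (-‿inverseʳ b) ⟩
    (c - d) + 0#          ≈⟨ +-identityʳ _ ⟩
    c - d                 ∎

  _≟ℤ_ : ∀ x y → Maybe (Induced-equivalence interpretation x y)
  (a , b) ≟ℤ (c , d) with a ℕ.+ d ℕ.≟ c ℕ.+ b
  ... | yes a+d≡c+b = just (difference-cong _ _ _ _
          (trans (sym (×-homo-+ 1# a d)) (trans (reflexive (≡.cong (_times 1#) a+d≡c+b)) (×-homo-+ 1# c b))))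
  ... | no _ = nothing

  open import Algebra.Solver.Ring ℤ-as-pairs (fromCommutativeRing R) interpretation _≟ℤ_ public
    using (solve; _:=_; _:+_; _:*_; :-_; _:-_)

module Development (R : CommutativeRing 0ℓ 0ℓ) where
  open CommutativeRing R hiding (zero)
  open RingDefs R
  open IntegerCoefficientSolver R
  module ≈-Reasoning = Relation.Binary.Reasoning.Setoid setoid
  open import Algebra.Properties.Ring ring using (-1*x≈-x)

  sum-cong : ∀ {K} {f g : Fin K → Carrier} → (∀ k → f k ≈ g k) → sumF f ≈ sumF g
  sum-cong {zero}  f≈g = refl
  sum-cong {suc K} f≈g = +-cong (f≈g zero) (sum-cong (f≈g ∘ suc))

  sum-zero : ∀ K → sumF {K} (λ _ → 0#) ≈ 0#
  sum-zero zero    = refl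
  sum-zero (suc K) = trans (+-identityˡ _) (sum-zero K)

  sum-+ : ∀ {K} (f g : Fin K → Carrier) → sumF (λ k → f k + g k) ≈ sumF f + sumF g
  sum-+ {zero}  f g = sym (+-identityʳ 0#)
  sum-+ {suc K} f g = trans (+-congˡ (sum-+ (f ∘ suc) (g ∘ suc)))
    (solve 4 (λ a b c d → (a :+ b) :+ (c :+ d) := (a :+ c) :+ (b :+ d)) refl
       (f zero) (g zero) (sumF (f ∘ suc)) (sumF (g ∘ suc)))

  sum-- : ∀ {K} (f g : Fin K → Carrier) → sumF (λ k → f k - g k) ≈ sumF f - sumF g
  sum-- {zero}  f g = sym (-‿inverseʳ 0#)
  sum-- {suc K} f g = trans (+-congˡ (sum-- (f ∘ suc) (g ∘ suc)))
    (solve 4 (λ a b c d → (a :- c) :+ (b :- d) := (a :+ b) :- (c :+ d)) refl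
       (f zero) (sumF (f ∘ suc)) (g zero) (sumF (g ∘ suc)))

  *-sum : ∀ {K} x (f : Fin K → Carrier) → x * sumF f ≈ sumF (λ k → x * f k)
  *-sum {zero}  x f = zeroʳ x
  *-sum {suc K} x f = trans (distribˡ x _ _) (+-congˡ (*-sum x (f ∘ suc)))

  sum-* : ∀ {K} x (f : Fin K → Carrier) → sumF f * x ≈ sumF (λ k → f k * x)
  sum-* {zero}  x f = zeroˡ x
  sum-* {suc K} x f = trans (distribʳ x _ _) (+-congˡ (sum-* x (f ∘ suc)))

  sum-swap : ∀ {K L} (f : Fin K → Fin L → Carrier) →
             sumF (λ k → sumF (λ l → f k l)) ≈ sumF (λ l → sumF (λ k → f k l))
  sum-swap {zero}  {L} f = sym (sum-zero L)
  sum-swap {suc K}     f = trans (+-congˡ (sum-swap (f ∘ suc))) (sym (sum-+ (f zero) _))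

  sum-const : ∀ K c → sumF {K} (λ _ → c) ≈ natR K * c
  sum-const zero    c = sym (zeroˡ c)
  sum-const (suc K) c = trans (+-congˡ (sum-const K c))
    (sym (trans (distribʳ c 1# (natR K)) (+-congʳ (*-identityˡ c))))

  sum-++ : ∀ {K L} (f : Fin K → Carrier) (g : Fin L → Carrier) → sumF (f ++ g) ≈ sumF f + sumF g
  sum-++ {zero}  f g = sym (+-identityˡ _)
  sum-++ {suc K} f g = trans (+-congˡ (trans (sum-cong tail-++) (sum-++ (f ∘ suc) g))) (sym (+-assoc _ _ _))
    where
    tail-++ : ∀ i → (f ++ g) (suc i) ≈ ((f ∘ suc) ++ g) i
    tail-++ i with splitAt K i
    ... | inj₁ _ = refl
    ... | inj₂ _ = refl

  sum-permute : ∀ {K} (σ : Permutation.Permutation′ K) (f : Fin K → Carrier) →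
                sumF (λ k → f (σ ⟨$⟩ʳ k)) ≈ sumF f
  sum-permute σ f = begin
    sumF (λ k → f (σ ⟨$⟩ʳ k))     ≈⟨ sumF≈sum (λ k → f (σ ⟨$⟩ʳ k)) ⟩
    Sum.sum (λ k → f (σ ⟨$⟩ʳ k))  ≈⟨ Sum.sum-permute f σ ⟨
    Sum.sum f                     ≈⟨ sumF≈sum f ⟨
    sumF f                        ∎
    where
    open ≈-Reasoning
    module Sum = Algebra.Properties.CommutativeMonoid.Sum +-commutativeMonoid
    sumF≈sum : ∀ {K} (f : Fin K → Carrier) → sumF f ≈ Sum.sum f
    sumF≈sum {zero}  f = refl
    sumF≈sum {suc K} f = +-congˡ (sumF≈sum (f ∘ suc))

  infix 4 _≋_
  _≋_ : ∀ {n} → Mat n → Mat n → Set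
  _≋_ = MatEq _≈_

  ≋-refl : ∀ {n} {P : Mat n} → P ≋ P
  ≋-refl i j = refl

  ≋-sym : ∀ {n} {P Q : Mat n} → P ≋ Q → Q ≋ P
  ≋-sym P≋Q i j = sym (P≋Q i j)

  ≋-trans : ∀ {n} {P Q S : Mat n} → P ≋ Q → Q ≋ S → P ≋ S
  ≋-trans P≋Q Q≋S i j = trans (P≋Q i j) (Q≋S i j)

  Mat-setoid : ℕ → Setoid 0ℓ 0ℓ
  Mat-setoid n = record
    { Carrier = Mat n ; _≈_ = _≋_
    ; isEquivalence = record { refl = ≋-refl ; sym = ≋-sym ; trans = ≋-trans } }

  module ≋-Reasoning {n} = Relation.Binary.Reasoning.Setoid (Mat-setoid n)

  ·-cong : ∀ {n} {P P' Q Q' : Mat n} → P ≋ P' → Q ≋ Q' → P · Q ≋ P' · Q'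
  ·-cong P≋P' Q≋Q' i j = sum-cong (λ l → *-cong (P≋P' i l) (Q≋Q' l j))

  ·-congˡ : ∀ {n} {P P' Q : Mat n} → P ≋ P' → P · Q ≋ P' · Q
  ·-congˡ P≋P' = ·-cong P≋P' ≋-refl

  ·-congʳ : ∀ {n} {P Q Q' : Mat n} → Q ≋ Q' → P · Q ≋ P · Q'
  ·-congʳ = ·-cong ≋-refl

  δ-· : ∀ {n} (P : Mat n) → δ · P ≋ P
  δ-· P i j = pick i (λ l → P l j)
    where
    pick : ∀ {n} i (x : Fin n → Carrier) → sumF (λ l → δ i l * x l) ≈ x i
    pick {suc n} zero x = trans (+-cong (*-identityˡ _) (trans (sum-cong (λ l → zeroˡ (x (suc l)))) (sum-zero n)))
                                (+-identityʳ _)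
    pick (suc i) x = trans (+-cong (zeroˡ _) (pick i (x ∘ suc))) (+-identityˡ _)

  ·-δ : ∀ {n} (P : Mat n) → P · δ ≋ P
  ·-δ P i j = pick j (λ l → P i l)
    where
    pick : ∀ {n} j (x : Fin n → Carrier) → sumF (λ l → x l * δ l j) ≈ x j
    pick {suc n} zero x = trans (+-cong (*-identityʳ _) (trans (sum-cong (λ l → zeroʳ (x (suc l)))) (sum-zero n)))
                                (+-identityʳ _)
    pick (suc j) x = trans (+-cong (zeroʳ _) (pick j (x ∘ suc))) (+-identityˡ _)

  ·-assoc : ∀ {n} (P Q S : Mat n) → (P · Q) · S ≋ P · (Q · S)
  ·-assoc P Q S i j = begin
    sumF (λ m → sumF (λ l → P i l * Q l m) * S m j)   ≈⟨ sum-cong (λ m → sum-* (S m j) (λ l → P i l * Q l m)) ⟩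
    sumF (λ m → sumF (λ l → P i l * Q l m * S m j))   ≈⟨ sum-swap (λ m l → P i l * Q l m * S m j) ⟩
    sumF (λ l → sumF (λ m → P i l * Q l m * S m j))   ≈⟨ sum-cong (λ l → sum-cong (λ m → *-assoc (P i l) (Q l m) (S m j))) ⟩
    sumF (λ l → sumF (λ m → P i l * (Q l m * S m j))) ≈⟨ sum-cong (λ l → sym (*-sum (P i l) (λ m → Q l m * S m j))) ⟩
    sumF (λ l → P i l * sumF (λ m → Q l m * S m j))   ∎
    where open ≈-Reasoning

  _+M_ _-M_ : ∀ {n} → Mat n → Mat n → Mat n
  (P +M Q) i j = P i j + Q i j
  (P -M Q) i j = P i j - Q i j

  _⋆_ : ∀ {n} → Carrier → Mat n → Mat n
  (c ⋆ P) i j = c * P i j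

  MSum : ∀ {K n} → (Fin K → Mat n) → Mat n
  MSum Ps i j = sumF (λ k → Ps k i j)

  ·-distribˡ-+ : ∀ {n} (P Q S : Mat n) → P · (Q +M S) ≋ (P · Q) +M (P · S)
  ·-distribˡ-+ P Q S i j = trans (sum-cong (λ l → distribˡ (P i l) (Q l j) (S l j)))
                                   (sum-+ (λ l → P i l * Q l j) (λ l → P i l * S l j))

  ·-distribʳ-+ : ∀ {n} (P Q S : Mat n) → (Q +M S) · P ≋ (Q · P) +M (S · P)
  ·-distribʳ-+ P Q S i j = trans (sum-cong (λ l → distribʳ (P l j) (Q i l) (S i l)))
                                   (sum-+ (λ l → Q i l * P l j) (λ l → S i l * P l j))

  ·-distribˡ-- : ∀ {n} (P Q S : Mat n) → P · (Q -M S) ≋ (P · Q) -M (P · S)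
  ·-distribˡ-- P Q S i j = trans (sum-cong (λ l →
      solve 3 (λ p q s → p :* (q :- s) := p :* q :- p :* s) refl (P i l) (Q l j) (S l j)))
      (sum-- (λ l → P i l * Q l j) (λ l → P i l * S l j))

  ·-distribʳ-- : ∀ {n} (P Q S : Mat n) → (Q -M S) · P ≋ (Q · P) -M (S · P)
  ·-distribʳ-- P Q S i j = trans (sum-cong (λ l →
      solve 3 (λ p q s → (q :- s) :* p := q :* p :- s :* p) refl (P l j) (Q i l) (S i l)))
      (sum-- (λ l → Q i l * P l j) (λ l → S i l * P l j))

  ·-⋆ʳ : ∀ {n} c (P Q : Mat n) → P · (c ⋆ Q) ≋ c ⋆ (P · Q)
  ·-⋆ʳ c P Q i j = trans (sum-cong (λ l → solve 3 (λ c p q → p :* (c :* q) := c :* (p :* q)) refl c (P i l) (Q l j)))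
                         (sym (*-sum c (λ l → P i l * Q l j)))

  ·-⋆ˡ : ∀ {n} c (P Q : Mat n) → (c ⋆ P) · Q ≋ c ⋆ (P · Q)
  ·-⋆ˡ c P Q i j = trans (sum-cong (λ l → *-assoc c (P i l) (Q l j))) (sym (*-sum c (λ l → P i l * Q l j)))

  ·-MSumʳ : ∀ {K n} (P : Mat n) (Qs : Fin K → Mat n) → P · MSum Qs ≋ MSum (λ k → P · Qs k)
  ·-MSumʳ P Qs i j = trans (sum-cong (λ l → *-sum (P i l) (λ k → Qs k l j))) (sum-swap (λ l k → P i l * Qs k l j))

  ·-MSumˡ : ∀ {K n} (P : Mat n) (Qs : Fin K → Mat n) → MSum Qs · P ≋ MSum (λ k → Qs k · P)
  ·-MSumˡ P Qs i j = trans (sum-cong (λ l → sum-* (P l j) (λ k → Qs k i l))) (sum-swap (λ l k → Qs k i l * P l j))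

  MSum-cong : ∀ {K n} {Ps Qs : Fin K → Mat n} → (∀ k → Ps k ≋ Qs k) → MSum Ps ≋ MSum Qs
  MSum-cong Ps≋Qs i j = sum-cong (λ k → Ps≋Qs k i j)

  conjugate-by-intertwiner : ∀ {n} {C D P Q : Mat n} → C · D ≋ δ → P · C ≋ C · Q → P ≋ (C · Q) · D
  conjugate-by-intertwiner {C = C} {D} {P} {Q} CD≋δ PC≋CQ = begin
    P             ≈⟨ ·-δ P ⟨
    P · δ         ≈⟨ ·-congʳ CD≋δ ⟨
    P · (C · D)   ≈⟨ ·-assoc P C D ⟨
    (P · C) · D   ≈⟨ ·-congˡ PC≋CQ ⟩
    (C · Q) · D   ∎
    where open ≋-Reasoning

  module Congruence (I : Ideal) where
    open Ideal I public

    mem-neg : ∀ {x} → mem x → mem (- x)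
    mem-neg {x} x∈I = mem-≈ (-1*x≈-x x) (mem-* (- 1#) x∈I)

    mem-*ʳ : ∀ r {x} → mem x → mem (x * r)
    mem-*ʳ r {x} x∈I = mem-≈ (*-comm r x) (mem-* r x∈I)

    mem-sum : ∀ {K} (f : Fin K → Carrier) → (∀ k → mem (f k)) → mem (sumF f)
    mem-sum {zero}  f f∈I = mem-0
    mem-sum {suc K} f f∈I = mem-+ (f∈I zero) (mem-sum (f ∘ suc) (f∈I ∘ suc))

    infix 4 _~_ _~M_
    _~_ : Carrier → Carrier → Set
    x ~ y = mem (x - y)

    ≈⇒~ : ∀ {x y} → x ≈ y → x ~ y
    ≈⇒~ {x} {y} x≈y = mem-≈ (sym (trans (+-congʳ x≈y) (-‿inverseʳ y))) mem-0

    ~-sym : ∀ {x y} → x ~ y → y ~ x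
    ~-sym {x} {y} x~y = mem-≈ (solve 2 (λ x y → :- (x :- y) := y :- x) refl x y) (mem-neg x~y)

    ~-trans : ∀ {x y z} → x ~ y → y ~ z → x ~ z
    ~-trans {x} {y} {z} x~y y~z =
      mem-≈ (solve 3 (λ x y z → (x :- y) :+ (y :- z) := x :- z) refl x y z) (mem-+ x~y y~z)

    +-absorb : ∀ x {y} → mem y → x + y ~ x
    +-absorb x {y} y∈I = mem-≈ (solve 2 (λ x y → y := (x :+ y) :- x) refl x y) y∈I

    -absorb : ∀ x {y} → mem y → x - y ~ x
    -absorb x {y} y∈I = mem-≈ (solve 2 (λ x y → :- y := (x :- y) :- x) refl x y) (mem-neg y∈I)

    _~M_ : ∀ {n} → Mat n → Mat n → Set
    _~M_ = MatEq _~_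

    ≋⇒~M : ∀ {n} {P Q : Mat n} → P ≋ Q → P ~M Q
    ≋⇒~M P≋Q i j = ≈⇒~ (P≋Q i j)

    ~M-refl : ∀ {n} {P : Mat n} → P ~M P
    ~M-refl = ≋⇒~M ≋-refl

    ~M-trans : ∀ {n} {P Q S : Mat n} → P ~M Q → Q ~M S → P ~M S
    ~M-trans P~Q Q~S i j = ~-trans (P~Q i j) (Q~S i j)

    ·-cong~ : ∀ {n} {P P' Q Q' : Mat n} → P ~M P' → Q ~M Q' → P · Q ~M P' · Q'
    ·-cong~ {P = P} {P'} {Q} {Q'} P~P' Q~Q' i j =
      mem-≈ (sum-- (λ l → P i l * Q l j) (λ l → P' i l * Q' l j)) (mem-sum _ λ l →
        mem-≈ (solve 4 (λ p p' q q' → (p :- p') :* q :+ p' :* (q :- q') := p :* q :- p' :* q') refl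
                 (P i l) (P' i l) (Q l j) (Q' l j))
              (mem-+ (mem-*ʳ (Q l j) (P~P' i l)) (mem-* (P' i l) (Q~Q' l j))))

  nonunit-≈ : ∀ {x y} → x ≈ y → InM x → InM y
  nonunit-≈ x≈y x∉units (s , ys≈1) = x∉units (s , trans (*-congʳ x≈y) ys≈1)

  nonunit-* : ∀ r {x} → InM x → InM (r * x)
  nonunit-* r {x} x∉units (s , rxs≈1) =
    x∉units (r * s , trans (solve 3 (λ x r s → x :* (r :* s) := (r :* x) :* s) refl x r s) rxs≈1)

  maximal-ideal : IsLocal → Ideal
  maximal-ideal (1≉0 , nonunit-+) = record
    { mem   = InM
    ; mem-≈ = nonunit-≈
    ; mem-0 = λ (s , 0s≈1) → 1≉0 (trans (sym 0s≈1) (zeroˡ s))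
    ; mem-+ = nonunit-+ _ _
    ; mem-* = nonunit-*
    }

  J-ideal : IsLocal → Carrier → Ideal
  J-ideal local c = record
    { mem   = InJ c
    ; mem-≈ = λ { x≈y (z , z∈m , x≈cz) → z , z∈m , trans (sym x≈y) x≈cz }
    ; mem-0 = 0# , m.mem-0 , sym (zeroʳ c)
    ; mem-+ = λ { (z , z∈m , x≈cz) (w , w∈m , y≈cw) →
                  z + w , m.mem-+ z∈m w∈m , trans (+-cong x≈cz y≈cw) (sym (distribˡ c z w)) }
    ; mem-* = λ { r (z , z∈m , x≈cz) →
                  r * z , m.mem-* r z∈m ,
                  trans (*-congˡ x≈cz) (solve 3 (λ r c z → r :* (c :* z) := c :* (r :* z)) refl r c z) }
    }
    where module m = Ideal (maximal-ideal local)

  -- The powers m^k are ideals, in any commutative ring.  For closure under +,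
  -- two expressions Σ aᵢbᵢ combine into one over the concatenated index set.
  power-ideal : ℕ → Ideal
  power-ideal k = record
    { mem = InMPow k ; mem-≈ = ≈-closed k ; mem-0 = 0-closed k ; mem-+ = +-closed k ; mem-* = *-closed k }
    where
    ≈-closed : ∀ k {x y} → x ≈ y → InMPow k x → InMPow k y
    ≈-closed zero    x≈y _ = tt
    ≈-closed (suc k) x≈y (K , a , b , a∈m , b∈mᵏ , x≈Σab) = K , a , b , a∈m , b∈mᵏ , trans (sym x≈y) x≈Σab

    0-closed : ∀ k → InMPow k 0#
    0-closed zero    = tt
    0-closed (suc k) = 0 , (λ ()) , (λ ()) , (λ ()) , (λ ()) , refl

    all-++ : ∀ {K L} (P : Carrier → Set) {f : Fin K → Carrier} {g : Fin L → Carrier} →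
             (∀ i → P (f i)) → (∀ i → P (g i)) → ∀ i → P ((f ++ g) i)
    all-++ {K} P Pf Pg i with splitAt K i
    ... | inj₁ i′ = Pf i′
    ... | inj₂ i′ = Pg i′

    zip-++ : ∀ {K L} (a b : Fin K → Carrier) (a′ b′ : Fin L → Carrier) →
             ∀ i → (a ++ a′) i * (b ++ b′) i ≈ ((λ i → a i * b i) ++ (λ i → a′ i * b′ i)) i
    zip-++ {K} a b a′ b′ i with splitAt K i
    ... | inj₁ _ = refl
    ... | inj₂ _ = refl

    +-closed : ∀ k {x y} → InMPow k x → InMPow k y → InMPow k (x + y)
    +-closed zero    _ _ = tt
    +-closed (suc k) (K , a , b , a∈m , b∈mᵏ , x≈Σab) (L , a′ , b′ , a′∈m , b′∈mᵏ , y≈Σa′b′) =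
      K ℕ.+ L , a ++ a′ , b ++ b′ , all-++ InM a∈m a′∈m , all-++ (InMPow k) b∈mᵏ b′∈mᵏ ,
      trans (+-cong x≈Σab y≈Σa′b′) (sym (trans (sum-cong (zip-++ a b a′ b′)) (sum-++ (λ i → a i * b i) (λ i → a′ i * b′ i))))

    *-closed : ∀ k r {x} → InMPow k x → InMPow k (r * x)
    *-closed zero    r _ = tt
    *-closed (suc k) r (K , a , b , a∈m , b∈mᵏ , x≈Σab) =
      K , (λ i → r * a i) , b , (λ i → nonunit-* r (a∈m i)) , b∈mᵏ ,
      trans (*-congˡ x≈Σab) (trans (*-sum r (λ i → a i * b i)) (sum-cong (λ i → sym (*-assoc r (a i) (b i)))))

  module Power (k : ℕ) = Congruence (power-ideal k)

  power-mono : ∀ {k l x} → k ℕ.≤ l → InMPow l x → InMPow k x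
  power-mono z≤n       _ = tt
  power-mono (s≤s k≤l) (K , a , b , a∈m , b∈mˡ , x≈Σab) = K , a , b , a∈m , (λ i → power-mono k≤l (b∈mˡ i)) , x≈Σab

  power-* : ∀ k {x y} → InM x → InMPow k y → InMPow (suc k) (x * y)
  power-* k {x} {y} x∈m y∈mᵏ = 1 , (λ _ → x) , (λ _ → y) , (λ _ → x∈m) , (λ _ → y∈mᵏ) , sym (+-identityʳ _)

  upper-bound : ∀ {K} (f : Fin K → ℕ) → ∃ λ B → ∀ k → f k ℕ.≤ B
  upper-bound {zero}  f = 0 , λ ()
  upper-bound {suc K} f with upper-bound (f ∘ suc)
  ... | B , f≤B = f zero ℕ.⊔ B , λ { zero → ℕₚ.m≤m⊔n (f zero) B ; (suc k) → ℕₚ.m≤n⇒m≤o⊔n (f zero) (f≤B k) }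

  infix 4 _≈[m^_]_ _≋[m^_]_
  _≈[m^_]_ : Carrier → ℕ → Carrier → Set
  x ≈[m^ k ] y = Power._~_ k x y

  _≋[m^_]_ : ∀ {n} → Mat n → ℕ → Mat n → Set
  P ≋[m^ k ] Q = Power._~M_ k P Q

  separated : IsComplete → ∀ {x y} → (∀ k → x ≈[m^ k ] y) → x ≈ y
  separated (_ , ⋂mᵏ≈0) {x} {y} x≈y = x∙y⁻¹≈ε⇒x≈y x y (⋂mᵏ≈0 (x - y) x≈y)
    where open import Algebra.Properties.Group +-group using (x∙y⁻¹≈ε⇒x≈y)

  -- Over a complete ring, if X has entries in m then I − X is invertible with
  -- inverse the limit L of the partial sums Sᵢ = I + X + ⋯ + X^(i−1): indeed
  -- (I − X)Sᵢ = Sᵢ(I − X) = I − X^i, and both Sᵢ − L and X^i lie in m^k for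
  -- large i, so (I − X)L ≡ I ≡ L(I − X) modulo every m^k.
  module NeumannSeries (complete : IsComplete) {n : ℕ} (X : Mat n) (X∈m : ∀ i j → InM (X i j)) where

    power : ℕ → Mat n
    power zero    = δ
    power (suc i) = X · power i

    partial : ℕ → Mat n
    partial zero    = λ _ _ → 0#
    partial (suc i) = partial i +M power i

    I-X : Mat n
    I-X = δ -M X

    power∈mⁱ : ∀ i a b → InMPow i (power i a b)
    power∈mⁱ zero    a b = tt
    power∈mⁱ (suc i) a b = Power.mem-sum (suc i) (λ l → X a l * power i l b) (λ l → power-* i (X∈m a l) (power∈mⁱ i l b))

    power-comm : ∀ i → power i · X ≋ X · power i
    power-comm zero    = ≋-trans (δ-· X) (≋-sym (·-δ X))
    power-comm (suc i) = ≋-trans (·-assoc X (power i) X) (·-congʳ (power-comm i))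

    telescope : ∀ x y z → (x - y) + (y - z) ≈ x - z
    telescope = solve 3 (λ x y z → (x :- y) :+ (y :- z) := x :- z) refl

    -- Telescoping: (I − X)Sᵢ = I − X^i, and likewise on the other side since
    -- X commutes with its powers.
    I-X-partial : ∀ i → I-X · partial i ≋ δ -M power i
    I-X-partial zero    a b = trans (trans (sum-cong (λ l → zeroʳ (I-X a l))) (sum-zero n)) (sym (-‿inverseʳ (δ a b)))
    I-X-partial (suc i) a b = begin
      (I-X · (partial i +M power i)) a b                        ≈⟨ ·-distribˡ-+ I-X (partial i) (power i) a b ⟩
      (I-X · partial i) a b + (I-X · power i) a b               ≈⟨ +-cong (I-X-partial i a b) (·-distribʳ-- (power i) δ X a b) ⟩
      (δ a b - power i a b) + ((δ · power i) a b - power (suc i) a b) ≈⟨ +-congˡ (+-congʳ (δ-· (power i) a b)) ⟩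
      (δ a b - power i a b) + (power i a b - power (suc i) a b) ≈⟨ telescope _ _ _ ⟩
      δ a b - power (suc i) a b                                 ∎
      where open ≈-Reasoning

    partial-I-X : ∀ i → partial i · I-X ≋ δ -M power i
    partial-I-X zero    a b = trans (trans (sum-cong (λ l → zeroˡ (I-X l b))) (sum-zero n)) (sym (-‿inverseʳ (δ a b)))
    partial-I-X (suc i) a b = begin
      ((partial i +M power i) · I-X) a b                        ≈⟨ ·-distribʳ-+ I-X (partial i) (power i) a b ⟩
      (partial i · I-X) a b + (power i · I-X) a b               ≈⟨ +-cong (partial-I-X i a b) (·-distribˡ-- (power i) δ X a b) ⟩
      (δ a b - power i a b) + ((power i · δ) a b - (power i · X) a b) ≈⟨ +-congˡ (+-cong (·-δ (power i) a b) (-‿cong (power-comm i a b))) ⟩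
      (δ a b - power i a b) + (power i a b - power (suc i) a b) ≈⟨ telescope _ _ _ ⟩
      δ a b - power (suc i) a b                                 ∎
      where open ≈-Reasoning

    partial-stable : ∀ k i → k ℕ.≤ i → ∀ a b → partial i a b ≈[m^ k ] partial k a b
    partial-stable _ zero    z≤n    a b = Power.≈⇒~ 0 (refl {0#})
    partial-stable k (suc i) k≤1+i a b with ℕₚ.m≤n⇒m<n∨m≡n k≤1+i
    ... | inj₂ ≡.refl = Power.≈⇒~ k refl
    ... | inj₁ k<1+i  = Power.~-trans k
            (Power.+-absorb k (partial i a b) (power-mono (ℕₚ.≤-pred k<1+i) (power∈mⁱ i a b)))
            (partial-stable k i (ℕₚ.≤-pred k<1+i) a b)

    cauchy : ∀ a b → IsCauchy (λ i → partial i a b)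
    cauchy a b k = k , λ i j k≤i k≤j →
      Power.~-trans k (partial-stable k i k≤i a b) (Power.~-sym k (partial-stable k j k≤j a b))

    limit : ∀ a b → ∃ (ConvergesTo (λ i → partial i a b))
    limit a b = proj₁ complete (λ i → partial i a b) (cauchy a b)

    L : Mat n
    L a b = proj₁ (limit a b)

    -- Entry (a , b) of Sᵢ agrees with L modulo m^k once i ≥ threshold k a b;
    -- large k exceeds k and all these thresholds.
    threshold : ℕ → Fin n → Fin n → ℕ
    threshold k a b = proj₁ (proj₂ (limit a b) k)

    row-bound : ∀ k a → ∃ λ B → ∀ b → threshold k a b ℕ.≤ B
    row-bound k a = upper-bound (threshold k a)

    all-bound : ∀ k → ∃ λ B → ∀ a → proj₁ (row-bound k a) ℕ.≤ B
    all-bound k = upper-bound (λ a → proj₁ (row-bound k a))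

    large : ℕ → ℕ
    large k = k ℕ.⊔ proj₁ (all-bound k)

    L≈partial : ∀ k → L ≋[m^ k ] partial (large k)
    L≈partial k a b = Power.~-sym k (proj₂ (proj₂ (limit a b) k) (large k) threshold≤large)
      where
      threshold≤large : threshold k a b ℕ.≤ large k
      threshold≤large = ℕₚ.≤-trans (proj₂ (row-bound k a) b)
                          (ℕₚ.≤-trans (proj₂ (all-bound k) a) (ℕₚ.m≤n⊔m k _))

    power-small : ∀ k a b → InMPow k (power (large k) a b)
    power-small k a b = power-mono (ℕₚ.m≤m⊔n k _) (power∈mⁱ (large k) a b)

    I-X-L : I-X · L ≋ δ
    I-X-L a b = separated complete λ k → Power.~-trans k
      (Power.·-cong~ k (Power.~M-refl k {P = I-X}) (L≈partial k) a b)
      (Power.~-trans k (Power.≈⇒~ k (I-X-partial (large k) a b)) (Power.-absorb k (δ a b) (power-small k a b)))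

    L-I-X : L · I-X ≋ δ
    L-I-X a b = separated complete λ k → Power.~-trans k
      (Power.·-cong~ k (L≈partial k) (Power.~M-refl k {P = I-X}) a b)
      (Power.~-trans k (Power.≈⇒~ k (partial-I-X (large k) a b)) (Power.-absorb k (δ a b) (power-small k a b)))

  invertible : IsComplete → ∀ {n} (A : Mat n) → (∀ i j → InM (A i j - δ i j)) →
               Σ (Mat n) λ B → (A · B ≋ δ) × (B · A ≋ δ)
  invertible complete {n} A A-I∈m = L , ≋-trans (·-congˡ A≋I-X) I-X-L , ≋-trans (·-congʳ A≋I-X) L-I-X
    where
    X : Mat n
    X = δ -M A
    X∈m : ∀ i j → InM (X i j)
    X∈m i j = nonunit-≈ (trans (-1*x≈-x _) (solve 2 (λ a d → :- (a :- d) := d :- a) refl (A i j) (δ i j)))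
                        (nonunit-* (- 1#) (A-I∈m i j))
    open NeumannSeries complete X X∈m
    A≋I-X : A ≋ I-X
    A≋I-X i j = solve 2 (λ a d → a := d :- (d :- a)) refl (A i j) (δ i j)

  cancel-scalar : ∀ {c n} {P Q : Mat n} → NonZeroDivisor c → c ⋆ P ≋ c ⋆ Q → P ≋ Q
  cancel-scalar {c} {P = P} {Q} c-nzd cP≋cQ i j = x∙y⁻¹≈ε⇒x≈y (P i j) (Q i j) (c-nzd (P i j - Q i j)
    (trans (solve 3 (λ c p q → c :* (p :- q) := c :* p :- c :* q) refl c (P i j) (Q i j))
           (trans (+-congʳ (cP≋cQ i j)) (-‿inverseʳ _))))
    where open import Algebra.Properties.Group +-group using (x∙y⁻¹≈ε⇒x≈y)

  sum-congruent : (local : IsLocal) → ∀ {K n} (Ms : Fin K → Mat n) (A : Mat n) →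
                  (∀ k → Congruence._~M_ (J-ideal local (natR K)) (Ms k) A) →
                  Σ (Mat n) λ A' → Congruence._~M_ (maximal-ideal local) A' A × (MSum Ms ≋ natR K ⋆ A')
  sum-congruent local {K} {n} Ms A Ms≡A = A +M Y , A'≡A , ΣMs≋KA'
    where
    module m = Congruence (maximal-ideal local)
    y : Fin K → Mat n
    y k i j = proj₁ (Ms≡A k i j)
    Y : Mat n
    Y = MSum y
    A'≡A : (A +M Y) m.~M A
    A'≡A i j = m.mem-≈ (solve 2 (λ a y → y := (a :+ y) :- a) refl (A i j) (Y i j))
                       (m.mem-sum (λ k → y k i j) (λ k → proj₁ (proj₂ (Ms≡A k i j))))
    ΣMs≋KA' : MSum Ms ≋ natR K ⋆ (A +M Y)
    ΣMs≋KA' i j = begin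
      sumF (λ k → Ms k i j)                         ≈⟨ sum-cong (λ k → trans (solve 2 (λ m a → m := (m :- a) :+ a) refl (Ms k i j) (A i j))
                                                                               (+-congʳ (proj₂ (proj₂ (Ms≡A k i j))))) ⟩
      sumF (λ k → natR K * y k i j + A i j)         ≈⟨ sum-+ (λ k → natR K * y k i j) (λ (_ : Fin K) → A i j) ⟩
      sumF (λ k → natR K * y k i j) + sumF (λ (_ : Fin K) → A i j) ≈⟨ +-cong (sym (*-sum (natR K) (λ k → y k i j))) (sum-const K (A i j)) ⟩
      natR K * Y i j + natR K * A i j               ≈⟨ solve 3 (λ c y a → c :* y :+ c :* a := c :* (a :+ y)) refl (natR K) (Y i j) (A i j) ⟩
      natR K * (A i j + Y i j)                      ∎
      where open ≈-Reasoning

  -- Sums over a finite group G, enumerated by e : Fin N → G, are invariant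
  -- under left translation, since g ↦ h g permutes the enumeration.
  module GroupSums (G : Group 0ℓ 0ℓ) {N : ℕ} (finite : IsFiniteOfOrder G N) where
    private module G = Group G

    e : Fin N → G.Carrier
    e = proj₁ finite

    index : G.Carrier → Fin N
    index g = proj₁ (proj₁ (proj₂ finite) g)

    e-index : ∀ g → e (index g) G.≈ g
    e-index g = proj₂ (proj₁ (proj₂ finite) g)

    e-injective : ∀ {k l} → e k G.≈ e l → k ≡.≡ l
    e-injective = proj₂ (proj₂ finite) _ _

    translation : G.Carrier → Permutation.Permutation′ N
    translation h = Permutation.permutation (λ k → index (h G.∙ e k)) (λ k → index (h G.⁻¹ G.∙ e k))
      (λ k → e-injective (cancel (G.inverseʳ h) (e-index _)))
      (λ k → e-injective (cancel (G.inverseˡ h) (e-index _)))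
      where
      cancel : ∀ {u v x y} → u G.∙ v G.≈ G.ε → e x G.≈ v G.∙ e y → e (index (u G.∙ e x)) G.≈ e y
      cancel {u} {v} {x} {y} uv≈ε ex≈vey = G.trans (e-index _) (G.trans (G.∙-congˡ ex≈vey)
        (G.trans (G.sym (G.assoc u v (e y))) (G.trans (G.∙-congʳ uv≈ε) (G.identityˡ (e y)))))

    sum-translate : (f : G.Carrier → Carrier) → (∀ {g g′} → g G.≈ g′ → f g ≈ f g′) →
                    ∀ h → sumF (λ k → f (h G.∙ e k)) ≈ sumF (λ k → f (e k))
    sum-translate f f-cong h = trans (sum-cong (λ k → f-cong (G.sym (e-index (h G.∙ e k)))))
                                     (sum-permute (translation h) (f ∘ e))

  module RepresentationFacts {G : Group 0ℓ 0ℓ} {n : ℕ} (rep : Rep G n) where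
    private module G = Group G
    open Rep rep public

    ρ-ε : ρ G.ε ≋ δ
    ρ-ε with ρ-inv G.ε
    ... | B , ρεB≋δ , _ = begin
      ρ G.ε                   ≈⟨ ·-δ (ρ G.ε) ⟨
      ρ G.ε · δ               ≈⟨ ·-congʳ ρεB≋δ ⟨
      ρ G.ε · (ρ G.ε · B)     ≈⟨ ·-assoc (ρ G.ε) (ρ G.ε) B ⟨
      (ρ G.ε · ρ G.ε) · B     ≈⟨ ·-congˡ (ρ-hom G.ε G.ε) ⟨
      ρ (G.ε G.∙ G.ε) · B     ≈⟨ ·-congˡ (ρ-≈ (G.identityˡ G.ε)) ⟩
      ρ G.ε · B               ≈⟨ ρεB≋δ ⟩
      δ                       ∎
      where open ≋-Reasoning

    ρ-inverse : ∀ g → ρ g · ρ (g G.⁻¹) ≋ δ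
    ρ-inverse g = ≋-trans (≋-sym (ρ-hom g (g G.⁻¹))) (≋-trans (ρ-≈ (G.inverseʳ g)) ρ-ε)

  module Lifting (local : IsLocal) (complete : IsComplete)
                 (G : Group 0ℓ 0ℓ) (N : ℕ) (finite : IsFiniteOfOrder G N)
                 (N-nzd : NonZeroDivisor (natR N)) {n : ℕ} (ρ₁ ρ₂ : Rep G n) where
    private module G = Group G
    open GroupSums G finite
    module J = Congruence (J-ideal local (natR N))
    module m = Congruence (maximal-ideal local)
    module R₁ = RepresentationFacts ρ₁
    module R₂ = RepresentationFacts ρ₂

    -- The average Σ_g ρ₁(g) C ρ₂(g⁻¹) of any matrix C intertwines ρ₂ with ρ₁:
    -- both ρ₁(h)·T and T·ρ₂(h) equal Σ_g F(g) for F(g) = ρ₁(g) C ρ₂(g⁻¹h),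
    -- the former after the translation g ↦ h g.
    summand : Mat n → Fin N → Mat n
    summand C k = (R₁.ρ (e k) · C) · R₂.ρ (e k G.⁻¹)

    average : Mat n → Mat n
    average C = MSum (summand C)

    average-intertwines : ∀ C h → R₁.ρ h · average C ≋ average C · R₂.ρ h
    average-intertwines C h = begin
      R₁.ρ h · average C                ≈⟨ ≋-trans (·-MSumʳ (R₁.ρ h) (summand C)) (MSum-cong translate-left) ⟩
      MSum (λ k → F (h G.∙ e k))       ≈⟨ (λ i j → sum-translate (λ g → F g i j) (λ g≈g′ → F-cong g≈g′ i j) h) ⟩
      MSum (λ k → F (e k))             ≈⟨ ≋-trans (·-MSumˡ (R₂.ρ h) (summand C)) (MSum-cong combine-right) ⟨
      average C · R₂.ρ h                ∎
      where
      open ≋-Reasoning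
      F : G.Carrier → Mat n
      F g = (R₁.ρ g · C) · R₂.ρ (g G.⁻¹ G.∙ h)

      F-cong : ∀ {g g′} → g G.≈ g′ → F g ≋ F g′
      F-cong g≈g′ = ·-cong (·-congˡ (R₁.ρ-≈ g≈g′)) (R₂.ρ-≈ (G.∙-congʳ (G.⁻¹-cong g≈g′)))

      [hg]⁻¹h≈g⁻¹ : ∀ g → (h G.∙ g) G.⁻¹ G.∙ h G.≈ g G.⁻¹
      [hg]⁻¹h≈g⁻¹ g = G.trans (G.∙-congʳ (⁻¹-anti-homo-∙ h g)) (G.trans (G.assoc _ _ _)
                        (G.trans (G.∙-congˡ (G.inverseˡ h)) (G.identityʳ _)))
        where open import Algebra.Properties.Group G using (⁻¹-anti-homo-∙)

      translate-left : ∀ k → R₁.ρ h · summand C k ≋ F (h G.∙ e k)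
      translate-left k = ≋-trans (≋-sym (·-assoc (R₁.ρ h) _ _))
        (·-cong (≋-trans (≋-sym (·-assoc (R₁.ρ h) (R₁.ρ (e k)) C)) (·-congˡ (≋-sym (R₁.ρ-hom h (e k)))))
                (R₂.ρ-≈ (G.sym ([hg]⁻¹h≈g⁻¹ (e k)))))

      combine-right : ∀ k → summand C k · R₂.ρ h ≋ F (e k)
      combine-right k = ≋-trans (·-assoc _ (R₂.ρ (e k G.⁻¹)) (R₂.ρ h)) (·-congʳ (≋-sym (R₂.ρ-hom (e k G.⁻¹) h)))

    -- Modulo J, if ρ₁ ≡ A ρ₂ B and B A ≡ I, every summand of the average of A
    -- is ≡ A:  ρ₁(g) A ρ₂(g⁻¹) ≡ (A ρ₂(g)) (B A) ρ₂(g⁻¹) ≡ A ρ₂(g) ρ₂(g⁻¹) = A.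
    summand≡A : ∀ {A B} → B · A J.~M δ → (∀ g → R₁.ρ g J.~M (A · R₂.ρ g) · B) →
                ∀ g → (R₁.ρ g · A) · R₂.ρ (g G.⁻¹) J.~M A
    summand≡A {A} {B} BA≡I ρ₁≡AρB g =
      J.~M-trans (J.·-cong~ (J.·-cong~ (ρ₁≡AρB g) J.~M-refl) J.~M-refl)
     (J.~M-trans (J.≋⇒~M regroup)
     (J.~M-trans (J.·-cong~ J.~M-refl (J.·-cong~ BA≡I J.~M-refl))
                 (J.≋⇒~M cancel)))
      where
      Y Z : Mat n
      Y = A · R₂.ρ g
      Z = R₂.ρ (g G.⁻¹)
      regroup : ((Y · B) · A) · Z ≋ Y · ((B · A) · Z)
      regroup = ≋-trans (·-assoc (Y · B) A Z) (≋-trans (·-assoc Y B (A · Z)) (·-congʳ (≋-sym (·-assoc B A Z))))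
      cancel : Y · (δ · Z) ≋ A
      cancel = ≋-trans (·-congʳ (δ-· Z)) (≋-trans (·-assoc A (R₂.ρ g) Z) (≋-trans (·-congʳ (R₂.ρ-inverse g)) (·-δ A)))

    reduce : StrictEquiv G ρ₁ ρ₂ → StrictEquivModJ G (natR N) ρ₁ ρ₂
    reduce (A , B , A∈I+m , AB≋I , BA≋I , ρ₁≋AρB) =
      A , B , A∈I+m , J.≋⇒~M AB≋I , J.≋⇒~M BA≋I , λ g → J.≋⇒~M (ρ₁≋AρB g)

    -- The average of A is N·A' with A' ∈ I + M_n(m); cancelling N, A' is an
    -- intertwiner, and it is invertible by completeness.
    lift : StrictEquivModJ G (natR N) ρ₁ ρ₂ → StrictEquiv G ρ₁ ρ₂
    lift (A , B , A∈I+m , _ , BA≡I , ρ₁≡AρB) =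
      A' , B' , A'∈I+m , A'B'≋I , B'A'≋I , λ g → conjugate-by-intertwiner A'B'≋I (A'-intertwines g)
      where
      averaged : Σ (Mat n) λ A' → (A' m.~M A) × (average A ≋ natR N ⋆ A')
      averaged = sum-congruent local (summand A) A (λ k → summand≡A BA≡I ρ₁≡AρB (e k))

      A' : Mat n
      A' = proj₁ averaged

      A'∈I+m : ∀ i j → InM (A' i j - δ i j)
      A'∈I+m i j = m.~-trans (proj₁ (proj₂ averaged) i j) (A∈I+m i j)

      average≋NA' : average A ≋ natR N ⋆ A'
      average≋NA' = proj₂ (proj₂ averaged)


      A'-intertwines : ∀ h → R₁.ρ h · A' ≋ A' · R₂.ρ h
      A'-intertwines h = cancel-scalar N-nzd (begin
        natR N ⋆ (R₁.ρ h · A')    ≈⟨ ·-⋆ʳ (natR N) (R₁.ρ h) A' ⟨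
        R₁.ρ h · (natR N ⋆ A')    ≈⟨ ·-congʳ average≋NA' ⟨
        R₁.ρ h · average A        ≈⟨ average-intertwines A h ⟩
        average A · R₂.ρ h        ≈⟨ ·-congˡ average≋NA' ⟩
        (natR N ⋆ A') · R₂.ρ h    ≈⟨ ·-⋆ˡ (natR N) A' (R₂.ρ h) ⟩
        natR N ⋆ (A' · R₂.ρ h)    ∎)
        where open ≋-Reasoning

      inverse : Σ (Mat n) λ B' → (A' · B' ≋ δ) × (B' · A' ≋ δ)
      inverse = invertible complete A' A'∈I+m

      B' : Mat n
      B' = proj₁ inverse

      A'B'≋I : A' · B' ≋ δ
      A'B'≋I = proj₁ (proj₂ inverse)

      B'A'≋I : B' · A' ≋ δ
      B'A'≋I = proj₂ (proj₂ inverse)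

lemma5p2 : (G : Group 0ℓ 0ℓ) (N : ℕ) → IsFiniteOfOrder G N →
           (R : CommutativeRing 0ℓ 0ℓ) →
           RingDefs.IsLocal R → RingDefs.IsNoetherian R → RingDefs.IsComplete R →
           RingDefs.FiniteResidueField R →
           RingDefs.NonZeroDivisor R (RingDefs.natR R N) →
           (n : ℕ) (ρ₁ ρ₂ : RingDefs.Rep R G n) →
           RingDefs.StrictEquiv R G ρ₁ ρ₂ ⇔ RingDefs.StrictEquivModJ R G (RingDefs.natR R N) ρ₁ ρ₂
lemma5p2 G N finite R local _ complete _ N-nzd n ρ₁ ρ₂ = mk⇔ reduce lift
  where open Development.Lifting R local complete G N finite N-nzd ρ₁ ρ₂
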